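{- Let $\mathcal{CS}$ be a pure $\mathsf{C}$-axiomatically appropriate constant specification. For any formulae $A$ and $B$ and any $s\in\mathrm{Tm}_{\mathsf{E}}$, if $\vdash_{\mathcal{CS}} B\to s{:}_{\mathsf{E}}(A\wedge B)$, then there exist a term $t\in\mathrm{Tm}_{\mathsf{C}}$ and a constant $c\in\mathrm{Cons}_{\mathsf{C}}$ with $c{:}_{\mathsf{C}}(A\wedge B\to A)\in\mathcal{CS}$ such that $\vdash_{\mathcal{CS}} B\to (c\cdot\mathsf{ind}(t,s)){:}_{\mathsf{C}}A$.
   Context: Fix a number $h\ge 1$ of agents. Throughout, $i$ ranges over $\{1,\dots,h\}$, $*$ over $\{1,\dots,h,\mathsf{C}\}$, and $\circledast$ over $\{1,\dots,h,\mathsf{E},\mathsf{C}\}$. For each $\circledast$ let $\mathrm{Cons}_\circledast$ (proof constants) and $\mathrm{Var}_\circledast$ (proof variables) be countably infinite sets, all pairwise disjoint. Evidence terms $\mathrm{Tm}_1,\dots,\mathrm{Tm}_h,\mathrm{Tm}_{\mathsf{E}},\mathrm{Tm}_{\mathsf{C}}$ are defined by simultaneous induction: $\mathrm{Cons}_\circledast\cup\mathrm{Var}_\circledast\subseteq\mathrm{Tm}_\circledast$; if $t\in\mathrm{Tm}_i$ then $!_i t\in\mathrm{Tm}_i$; if $t,s\in\mathrm{Tm}_*$ then $t+_*s,\ t\cdot_* s\in\mathrm{Tm}_*$; if $t_1\in\mathrm{Tm}_1,\dots,t_h\in\mathrm{Tm}_h$ then $\langle t_1,\dots,t_h\rangle\in\mathrm{Tm}_{\mathsf{E}}$;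 if $t\in\mathrm{Tm}_{\mathsf{E}}$ then $\pi_i t\in\mathrm{Tm}_i$; if $t\in\mathrm{Tm}_{\mathsf{C}}$ then $\mathsf{hd}(t),\mathsf{tl}(t)\in\mathrm{Tm}_{\mathsf{E}}$; if $t\in\mathrm{Tm}_{\mathsf{C}}$ and $s\in\mathrm{Tm}_{\mathsf{E}}$ then $\mathsf{ind}(t,s)\in\mathrm{Tm}_{\mathsf{C}}$. Formulae are built from a countable set $\mathrm{Prop}$ of propositional variables using $\neg,\wedge,\vee,\to$ and the rule: if $A$ is a formula and $t\in\mathrm{Tm}_\circledast$ then $t{:}_\circledast A$ is a formula ($c\cdot u$ for $c,u\in\mathrm{Tm}_{\mathsf{C}}$ denotes $c\cdot_{\mathsf{C}}u$). Axioms of $\mathsf{LP}^{\mathsf{C}}_h$ (all instances): (1) propositional tautologies; (2) $t{:}_*(A\to B)\to(s{:}_*A\to (t\cdot s){:}_*B)$; (3) $t{:}_*A\to(t+s){:}_*A$ and $s{:}_*A\to(t+s){:}_*A$; (4) $t{:}_iA\to A$; (5) $t{:}_iA\to (!t){:}_i\, t{:}_iA$; (6) $t_1{:}_1A\wedge\dots\wedge t_h{:}_hA\to\langle t_1,\dots,t_h\rangle{:}_{\mathsf{E}}A$; (7) $t{:}_{\mathsf{E}}A\to (\pi_it){:}_iA$; (8) $t{:}_{\mathsf{C}}A\to\mathsf{hd}(t){:}_{\mathsf{E}}A$ and $t{:}_{\mathsf{C}}A\to\mathsf{tl}(t){:}_{\mathsf{E}}\,t{:}_{\mathsf{C}}A$;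 (9) $A\wedge t{:}_{\mathsf{C}}(A\to s{:}_{\mathsf{E}}A)\to\mathsf{ind}(t,s){:}_{\mathsf{C}}A$. A constant specification $\mathcal{CS}$ is any set of formulae $c{:}_\circledast A$ with $c\in\mathrm{Cons}_\circledast$ and $A$ an axiom. It is $\mathsf{C}$-axiomatically appropriate if for each axiom $A$ there is $c\in\mathrm{Cons}_{\mathsf{C}}$ with $c{:}_{\mathsf{C}}A\in\mathcal{CS}$; it is pure if there is a fixed $\circledast$ with $\mathcal{CS}\subseteq\{c{:}_\circledast A: c\in\mathrm{Cons}_\circledast, A \text{ an axiom}\}$. $\mathsf{LP}^{\mathsf{C}}_h(\mathcal{CS})$ is the Hilbert system with these axioms, modus ponens, and axiom necessitation (derive $c{:}_\circledast A$ whenever $c{:}_\circledast A\in\mathcal{CS}$); $\vdash_{\mathcal{CS}}A$ means $A$ is derivable in it. -}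

module Defs where

open import Data.Nat using (ℕ)
open import Data.Fin using (Fin)
open import Data.List using (List; []; _∷_; tabulate)
open import Data.Bool using (Bool; true; false; not; _∧_; _∨_)
open import Data.Product using (Σ; ∃; _×_; _,_)
open import Relation.Binary.PropositionalEquality using (_≡_)

data Idx (h : ℕ) : Set where
  ag : Fin h → Idx h
  E  : Idx h
  C  : Idx h

data IsStar {h : ℕ} : Idx h → Set where
  agS : (i : Fin h) → IsStar (ag i)
  CS  : IsStar C

-- Proof constants and proof variables of each sort: countably infinite,
-- pairwise disjoint (indexed by ℕ and tagged by constructor and sort).
data Tm (h : ℕ) : Idx h → Set where
  cons  : (k : Idx h) → ℕ → Tm h k
  var   : (k : Idx h) → ℕ → Tm h k
  bang  : (i : Fin h) → Tm h (ag i) → Tm h (ag i)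
  plus  : {k : Idx h} → IsStar k → Tm h k → Tm h k → Tm h k
  app   : {k : Idx h} → IsStar k → Tm h k → Tm h k → Tm h k
  tuple : ((i : Fin h) → Tm h (ag i)) → Tm h E
  proj  : (i : Fin h) → Tm h E → Tm h (ag i)
  hd    : Tm h C → Tm h E
  tl    : Tm h C → Tm h E
  ind   : Tm h C → Tm h E → Tm h C

data Fm (h : ℕ) : Set where
  atom  : ℕ → Fm h
  ¬'_   : Fm h → Fm h
  _∧'_  : Fm h → Fm h → Fm h
  _∨'_  : Fm h → Fm h → Fm h
  _⇒_   : Fm h → Fm h → Fm h
  just  : (k : Idx h) → Tm h k → Fm h → Fm h

infixr 5 _⇒_
infixr 6 _∧'_ _∨'_

-- Boolean evaluation treating atoms and justification formulae as
-- propositional atoms.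
eval : {h : ℕ} → (Fm h → Bool) → Fm h → Bool
eval v (atom p)     = v (atom p)
eval v (¬' A)       = not (eval v A)
eval v (A ∧' B)     = eval v A ∧ eval v B
eval v (A ∨' B)     = eval v A ∨ eval v B
eval v (A ⇒ B)      = not (eval v A) ∨ eval v B
eval v (just k t A) = v (just k t A)

Tautology : {h : ℕ} → Fm h → Set
Tautology {h} A = (v : Fm h → Bool) → eval v A ≡ true

-- Conjunction of a nonempty list, right-nested: A₁ ∧ (A₂ ∧ … ∧ Aₙ).
-- (The empty case never arises since h ≥ 1; it is set to a tautology.)
conjL : {h : ℕ} → List (Fm h) → Fm h
conjL []           = atom 0 ⇒ atom 0
conjL (A ∷ [])     = A
conjL (A ∷ B ∷ Bs) = A ∧' conjL (B ∷ Bs)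

data Axiom {h : ℕ} : Fm h → Set where
  taut  : {A : Fm h} → Tautology A → Axiom A
  appl  : {k : Idx h} (p : IsStar k) (t s : Tm h k) (A B : Fm h) →
          Axiom (just k t (A ⇒ B) ⇒ (just k s A ⇒ just k (app p t s) B))
  sumL  : {k : Idx h} (p : IsStar k) (t s : Tm h k) (A : Fm h) →
          Axiom (just k t A ⇒ just k (plus p t s) A)
  sumR  : {k : Idx h} (p : IsStar k) (t s : Tm h k) (A : Fm h) →
          Axiom (just k s A ⇒ just k (plus p t s) A)
  refl' : (i : Fin h) (t : Tm h (ag i)) (A : Fm h) →
          Axiom (just (ag i) t A ⇒ A)
  intro : (i : Fin h) (t : Tm h (ag i)) (A : Fm h) →
          Axiom (just (ag i) t A ⇒ just (ag i) (bang i t) (just (ag i) t A))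
  tupl  : (ts : (i : Fin h) → Tm h (ag i)) (A : Fm h) →
          Axiom (conjL (tabulate (λ i → just (ag i) (ts i) A)) ⇒ just E (tuple ts) A)
  prj   : (i : Fin h) (t : Tm h E) (A : Fm h) →
          Axiom (just E t A ⇒ just (ag i) (proj i t) A)
  hdAx  : (t : Tm h C) (A : Fm h) → Axiom (just C t A ⇒ just E (hd t) A)
  tlAx  : (t : Tm h C) (A : Fm h) →
          Axiom (just C t A ⇒ just E (tl t) (just C t A))
  indAx : (t : Tm h C) (s : Tm h E) (A : Fm h) →
          Axiom ((A ∧' just C t (A ⇒ just E s A)) ⇒ just C (ind t s) A)

IsConstSpec : {h : ℕ} → (Fm h → Set) → Set
IsConstSpec {h} CS' = (F : Fm h) → CS' F →
  Σ (Idx h) λ k → Σ ℕ λ c → Σ (Fm h) λ A → (F ≡ just k (cons k c) A) × Axiom A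

CAxApp : {h : ℕ} → (Fm h → Set) → Set
CAxApp {h} CS' = (A : Fm h) → Axiom A → Σ ℕ λ c → CS' (just C (cons C c) A)

Pure : {h : ℕ} → (Fm h → Set) → Set
Pure {h} CS' = Σ (Idx h) λ k → (F : Fm h) → CS' F →
  Σ ℕ λ c → Σ (Fm h) λ A → (F ≡ just k (cons k c) A) × Axiom A

data _⊢_ {h : ℕ} (CS' : Fm h → Set) : Fm h → Set where
  ax  : {A : Fm h} → Axiom A → CS' ⊢ A
  mp  : {A B : Fm h} → CS' ⊢ (A ⇒ B) → CS' ⊢ A → CS' ⊢ B
  nec : (k : Idx h) (c : ℕ) (A : Fm h) → CS' (just k (cons k c) A) →
        CS' ⊢ just k (cons k c) A

infix 2 _⊢_

-- Weakening the hypothesis gives ⊢ A ∧ B → s:_E(A ∧ B), so A ∧ B is an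
-- s-inductive formula. Internalizing this derivation into a C-term t and feeding
-- it to the induction axiom yields ⊢ A ∧ B → ind(t,s):_C(A ∧ B); prefixing the
-- C-constant for A ∧ B → A turns this into a justification of A. Finally B
-- implies A ∧ B, since s:_E(A ∧ B) is factive through any agent (h ≥ 1).
module Submission where

open import Defs
open import Data.Nat using (ℕ; _≤_)
open import Data.Fin using (Fin; fromℕ<)
open import Data.Product using (Σ; _×_; _,_)
open import Data.Bool using (true; false)
open import Relation.Binary.PropositionalEquality using (_≡_; refl)

module _ {h : ℕ} where

  hypothetical-syllogism : (P Q R : Fm h) → Tautology ((P ⇒ Q) ⇒ (Q ⇒ R) ⇒ P ⇒ R)
  hypothetical-syllogism P Q R v with eval v P | eval v Q | eval v R
  ... | true  | true  | true  = refl
  ... | true  | true  | false = refl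
  ... | true  | false | _     = refl
  ... | false | true  | true  = refl
  ... | false | true  | false = refl
  ... | false | false | true  = refl
  ... | false | false | false = refl

  ∧-introduction : (P Q : Fm h) → Tautology (P ⇒ Q ⇒ P ∧' Q)
  ∧-introduction P Q v with eval v P | eval v Q
  ... | true  | true  = refl
  ... | true  | false = refl
  ... | false | _     = refl

  ∧-eliminationˡ : (P Q : Fm h) → Tautology (P ∧' Q ⇒ P)
  ∧-eliminationˡ P Q v with eval v P | eval v Q
  ... | true  | true  = refl
  ... | true  | false = refl
  ... | false | _     = refl

  ∧-eliminationʳ : (P Q : Fm h) → Tautology (P ∧' Q ⇒ Q)
  ∧-eliminationʳ P Q v with eval v P | eval v Q
  ... | true  | true  = refl
  ... | true  | false = refl
  ... | false | _     = refl

  exportation : (P Q R : Fm h) → Tautology ((P ∧' Q ⇒ R) ⇒ Q ⇒ P ⇒ R)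
  exportation P Q R v with eval v P | eval v Q | eval v R
  ... | true  | true  | true  = refl
  ... | true  | true  | false = refl
  ... | true  | false | true  = refl
  ... | true  | false | false = refl
  ... | false | true  | true  = refl
  ... | false | true  | false = refl
  ... | false | false | true  = refl
  ... | false | false | false = refl

  module _ {CS' : Fm h → Set} where

    ⇒-trans : {P Q R : Fm h} → CS' ⊢ P ⇒ Q → CS' ⊢ Q ⇒ R → CS' ⊢ P ⇒ R
    ⇒-trans {P} {Q} {R} d e = mp (mp (ax (taut (hypothetical-syllogism P Q R))) d) e

    ∧-intro : {P Q : Fm h} → CS' ⊢ P → CS' ⊢ Q → CS' ⊢ P ∧' Q
    ∧-intro {P} {Q} d e = mp (mp (ax (taut (∧-introduction P Q))) d) e

    export : {P Q R : Fm h} → CS' ⊢ P ∧' Q ⇒ R → CS' ⊢ Q → CS' ⊢ P ⇒ R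
    export {P} {Q} {R} d e = mp (mp (ax (taut (exportation P Q R))) d) e

    E-factivity : Fin h → {s : Tm h E} {A : Fm h} → CS' ⊢ just E s A ⇒ A
    E-factivity i {s} {A} = ⇒-trans (ax (prj i s A)) (ax (refl' i (proj i s) A))

    application-under : {X P Q : Fm h} {u t : Tm h C} →
      CS' ⊢ just C u (P ⇒ Q) → CS' ⊢ X ⇒ just C t P → CS' ⊢ X ⇒ just C (app CS u t) Q
    application-under {P = P} {Q} {u} {t} du d = ⇒-trans d (mp (ax (appl CS u t P Q)) du)

    -- Appropriateness puts some C-constant into the specification, and purity
    -- then forces every constant in it to be a C-constant.
    pure-spec-sort≡C : Pure CS' → CAxApp CS' → {k : Idx h} {c : ℕ} {A : Fm h} →
      CS' (just k (cons k c) A) → k ≡ C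
    pure-spec-sort≡C (_ , pure) appropriate p with appropriate _ (tlAx (cons C 0) (atom 0))
    ... | _ , q with pure _ q | pure _ p
    ... | _ , _ , refl , _ | _ , _ , refl , _ = refl

    -- C has no positive introspection axiom; instead the induction axiom is
    -- applied to the tail axiom c:A → tl(c):_E c:A.
    constant-introspection : CAxApp CS' → {c : ℕ} {A : Fm h} → CS' (just C (cons C c) A) →
      Σ (Tm h C) λ t → CS' ⊢ just C t (just C (cons C c) A)
    constant-introspection appropriate {c} {A} p with appropriate _ (tlAx (cons C c) A)
    ... | c' , q = ind (cons C c') (tl (cons C c)) ,
                   mp (ax (indAx _ _ _)) (∧-intro (nec C c A p) (nec C c' _ q))

    module _ (pure : Pure CS') (appropriate : CAxApp CS') where

      internalization : {F : Fm h} → CS' ⊢ F → Σ (Tm h C) λ t → CS' ⊢ just C t F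
      internalization (ax a) with appropriate _ a
      ... | c , p = cons C c , nec C c _ p
      internalization (mp d e) =
        let t , dt = internalization d
            u , du = internalization e
        in app CS t u , mp (mp (ax (appl CS t u _ _)) dt) du
      internalization (nec k c A p) with pure-spec-sort≡C pure appropriate p
      ... | refl = constant-introspection appropriate p

      induction-rule : {A : Fm h} {s : Tm h E} →
        CS' ⊢ A ⇒ just E s A → Σ (Tm h C) λ t → CS' ⊢ A ⇒ just C (ind t s) A
      induction-rule {A} {s} d =
        let t , dt = internalization d
        in t , export (ax (indAx t s A)) dt

lemma7 : (h : ℕ) → 1 ≤ h → (CS' : Fm h → Set) → IsConstSpec CS' →
    Pure CS' → CAxApp CS' → (A B : Fm h) (s : Tm h E) →
    CS' ⊢ (B ⇒ just E s (A ∧' B)) →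
    Σ (Tm h C) λ t → Σ ℕ λ c → CS' (just C (cons C c) ((A ∧' B) ⇒ A)) ×
    (CS' ⊢ (B ⇒ just C (app CS (cons C c) (ind t s)) A))
lemma7 h h≥1 CS' _ pure appropriate A B s B⇒s∶A∧B =
  let t , A∧B⇒ind∶A∧B = induction-rule pure appropriate A∧B-inductive
      c , c∶A∧B⇒A     = appropriate _ (taut (∧-eliminationˡ A B))
  in t , c , c∶A∧B⇒A , ⇒-trans B⇒A∧B (application-under (nec C c _ c∶A∧B⇒A) A∧B⇒ind∶A∧B)
  where
  A∧B-inductive : CS' ⊢ A ∧' B ⇒ just E s (A ∧' B)
  A∧B-inductive = ⇒-trans (ax (taut (∧-eliminationʳ A B))) B⇒s∶A∧B

  B⇒A∧B : CS' ⊢ B ⇒ A ∧' B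
  B⇒A∧B = ⇒-trans B⇒s∶A∧B (E-factivity (fromℕ< h≥1))
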